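{- Let $\Sigma$ be a signature, $T$ the effect-tree monad over $\Sigma$, and $\mathcal{E}\subseteq(T\mathbb{N})^2$ a reflexive, transitive and compositional algebraic relation. Let $c$ be a choice function for $[\mathcal{E}_0]$. Then $\alpha_c:T[\mathcal{E}_0]\to[\mathcal{E}_0]$ is an Eilenberg–Moore algebra for $T$, i.e. $\alpha_c\circ\eta_{[\mathcal{E}_0]}=\mathrm{id}$ and $\alpha_c\circ T\alpha_c=\alpha_c\circ\mu_{[\mathcal{E}_0]}$.
   Context: A signature $\Sigma$ is a set of operators with arities in $\mathbb{N}\cup\{\mathbb{N}\}$. For a set $X$, $TX$ is the set of possibly infinite-depth trees with leaves $\bot$, $\top$, or $\langle x\rangle$ ($x\in X$), and internal nodes labelled by operators $\sigma$ with $|\sigma|$ children (indexed by $\mathbb{N}$ if $|\sigma|=\mathbb{N}$). $T$ is a functor ($Tf$ relabels leaves) and a monad with $\eta(x)=\langle x\rangle$ and $\mu:TTX\to TX$ replacing each leaf $\langle t\rangle$ by the subtree $t$; for $f:X\to TY$, $f^*:=\mu\circ Tf$. Let $\mathbf{0}=\emptyset\subseteq\mathbb{N}$, so $T\mathbf{0}\subseteq T\mathbb{N}$ consists of trees with only $\bot,\top$ leaves. An algebraic relation is $\mathcal{E}\subseteq(T\mathbb{N})^2$, written $a\,\mathcal{E}\,b$. Reflexive and transitive as usual; compositional: if $a\,\mathcal{E}\,b$ and $f(n)\,\mathcal{E}\,g(n)$ for all $n$ (for $f,g:\mathbb{N}\to T\mathbb{N}$), then $f^*(a)\,\mathcal{E}\,g^*(b)$.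 Let $\mathcal{E}_0=\mathcal{E}\cap(T\mathbf{0})^2$, $[a]=\{b\in T\mathbf{0}\mid a\,\mathcal{E}_0\,b,\ b\,\mathcal{E}_0\,a\}$, $[\mathcal{E}_0]=\{[a]\mid a\in T\mathbf{0}\}$, $[-]:a\mapsto[a]$. A choice function is $c:[\mathcal{E}_0]\to T\mathbf{0}$ with $c(S)\in S$, and $\alpha_c:=[-]\circ\mu_{\mathbf{0}}\circ Tc$. -}

module Defs where

open import Level using (Level)
open import Data.Nat using (ℕ; _<_)
open import Data.Unit using (⊤)
open import Data.Empty using (⊥; ⊥-elim)
open import Data.List using (List; []; _∷_)
open import Data.Product using (Σ-syntax; ∃-syntax; _×_; _,_; proj₁)
open import Function.Bundles using (_⇔_; mk⇔)
open import Relation.Binary.PropositionalEquality using (_≡_)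

-- Arities are elements of ℕ ∪ {ℕ}.
data Arity : Set where
  fin : ℕ → Arity
  nat : Arity

IsPos : Arity → ℕ → Set
IsPos (fin n) i = i < n
IsPos nat     i = ⊤

record Signature : Set₁ where
  field
    Op : Set
    ar : Op → Arity

open Signature public

-- Possibly infinite-depth trees, represented positionally.
-- A tree assigns a label to every finite path (list of child indices,
-- root first); only the labels at reachable paths matter, and equality
-- of trees is agreement at all reachable paths (_≈T_).

data Lab (S : Signature) {a : Level} (X : Set a) : Set a where
  bot top : Lab S X
  leaf    : X → Lab S X
  op      : Op S → Lab S X

T : (S : Signature) {a : Level} → Set a → Set a
T S X = List ℕ → Lab S X

module _ {S : Signature} where

  child : ∀ {a} {X : Set a} → T S X → ℕ → T S X
  child t i p = t (i ∷ p)

  Valid : ∀ {a} {X : Set a} → T S X → List ℕ → Set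
  Valid t []      = ⊤
  Valid t (i ∷ p) = ValidStep (t []) i × Valid (child t i) p
    where
    ValidStep : Lab S _ → ℕ → Set
    ValidStep (op σ) i = IsPos (ar S σ) i
    ValidStep _      i = ⊥

  _≈T_ : ∀ {a} {X : Set a} → T S X → T S X → Set a
  s ≈T t = ∀ p → Valid s p → s p ≡ t p

  η : ∀ {a} {X : Set a} → X → T S X
  η x _ = leaf x

  mapLab : ∀ {a b} {X : Set a} {Y : Set b} → (X → Y) → Lab S X → Lab S Y
  mapLab f bot      = bot
  mapLab f top      = top
  mapLab f (leaf x) = leaf (f x)
  mapLab f (op σ)   = op σ

  mapT : ∀ {a b} {X : Set a} {Y : Set b} → (X → Y) → T S X → T S Y
  mapT f t p = mapLab f (t p)

  μ : ∀ {a} {X : Set a} → T S (T S X) → T S X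
  μ t p = go (t []) p
    where
    go : Lab S _ → List ℕ → Lab S _
    go (leaf s) q       = s q
    go bot      []      = bot
    go top      []      = top
    go (op σ)   []      = op σ
    go _        (i ∷ q) = μ (child t i) q

  _* : ∀ {a b} {X : Set a} {Y : Set b} → (X → T S Y) → T S X → T S Y
  (f *) t = μ (mapT f t)

  T𝟎 : Set
  T𝟎 = T S ⊥

  Tℕ : Set
  Tℕ = T S ℕ

  incl : T𝟎 → Tℕ
  incl = mapT ⊥-elim

  AlgRel : Set₁
  AlgRel = Tℕ → Tℕ → Set

  module _ (E : AlgRel) where

    IsReflexive : Set
    IsReflexive = ∀ a → E a a

    IsTransitive : Set
    IsTransitive = ∀ {a b c} → E a b → E b c → E a c

    IsCompositional : Set
    IsCompositional = ∀ {a b} (f g : ℕ → Tℕ) →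
      E a b → (∀ n → E (f n) (g n)) → E ((f *) a) ((g *) b)

    -- E is a relation on the set Tℕ, whose equality is _≈T_.
    RespectsEq : Set
    RespectsEq = ∀ {a a′ b b′} → a ≈T a′ → b ≈T b′ → E a b → E a′ b′

    E₀ : T𝟎 → T𝟎 → Set
    E₀ a b = E (incl a) (incl b)

    ⟦_⟧ : T𝟎 → (T𝟎 → Set)
    ⟦ a ⟧ b = E₀ a b × E₀ b a

    -- [𝓔₀] = { [a] | a ∈ T𝟎 }: subsets of T𝟎 that are (extensionally) some [a]
    Class : Set₁
    Class = Σ[ P ∈ (T𝟎 → Set) ] ∃[ a ] (∀ b → P b ⇔ ⟦ a ⟧ b)

    _∈C_ : T𝟎 → Class → Set
    b ∈C C = proj₁ C b

    _≐_ : Class → Class → Set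
    (P , _) ≐ (Q , _) = ∀ b → P b ⇔ Q b

    [_] : T𝟎 → Class
    [ a ] = ⟦ a ⟧ , a , λ b → mk⇔ (λ x → x) (λ x → x)

    record ChoiceFunction : Set₁ where
      field
        c  : Class → T𝟎
        c∈ : ∀ C → c C ∈C C

    open ChoiceFunction public

    α : ChoiceFunction → T S Class → Class
    α ch t = [ μ (mapT (c ch) t) ]

module Submission where

-- Write c* s = μ (T c s) for s : T[𝓔₀], so α_c s = [c* s].  A class is the
-- class of each of its members, hence:
--   * unit law: α_c (η C) = [c C] = C, because c C ∈ C;
--   * multiplication law: it suffices that c* (T α_c t) and c* (μ t) are
--     𝓔₀-equivalent.  By the Kleisli laws of T they are the substitutions
--     into t of s ↦ c [c* s] and of s ↦ c* s, which are 𝓔-equivalent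
--     because c [x] ∈ [x].
-- The crux is that substitution into a tree with leaves in an ARBITRARY set
-- Y is monotone in the substituted trees.  Compositionality only speaks about
-- leaves in ℕ; we reduce to it by relabelling every leaf of t with a numeric
-- code of its path, which needs List ℕ to be a retract of ℕ.

open import Defs
open import Data.Product using (_×_; _,_; proj₁; proj₂; ∃-syntax)
open import Data.Nat using (ℕ; zero; suc; _+_)
open import Data.Nat.Properties using (+-identityʳ; +-suc)
open import Data.List using (List; []; _∷_; length)
open import Data.Empty using (⊥-elim)
open import Function.Base using (_∘_)
open import Function.Bundles using (mk⇔; Equivalence)
open import Relation.Binary.PropositionalEquality
  using (_≡_; refl; sym; trans; cong; _≗_)

-- Cantor's enumeration of ℕ × ℕ, walking each diagonal x + y = d
-- from (d , 0) down to (0 , d) and then moving on to (d + 1 , 0).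
nextOnDiagonal : ℕ × ℕ → ℕ × ℕ
nextOnDiagonal (zero  , y) = suc y , 0
nextOnDiagonal (suc x , y) = x , suc y

unpair : ℕ → ℕ × ℕ
unpair zero    = 0 , 0
unpair (suc n) = nextOnDiagonal (unpair n)

Enumerated : ℕ → ℕ → Set
Enumerated x y = ∃[ n ] unpair n ≡ (x , y)

walkDiagonal : ∀ y x → Enumerated (x + y) 0 → Enumerated x y
walkDiagonal zero    x h rewrite +-identityʳ x = h
walkDiagonal (suc y) x h rewrite +-suc x y with walkDiagonal y (suc x) h
... | n , e = suc n , cong nextOnDiagonal e

-- Every diagonal is started: (d + 1 , 0) follows the end (0 , d) of diagonal d.
diagonalStart : ∀ d → Enumerated d 0
diagonalStart zero    = 0 , refl
diagonalStart (suc d) with walkDiagonal d 0 (diagonalStart d)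
... | n , e = suc n , cong nextOnDiagonal e

unpair-surjective : ∀ x y → Enumerated x y
unpair-surjective x y = walkDiagonal y x (diagonalStart (x + y))

pair : ℕ → ℕ → ℕ
pair x y = proj₁ (unpair-surjective x y)

unpair-pair : ∀ x y → unpair (pair x y) ≡ (x , y)
unpair-pair x y = proj₂ (unpair-surjective x y)

-- A list is coded by its length paired with the iterated pairing of its
-- entries; the length tells the decoder when to stop.
encodeEntries : List ℕ → ℕ
encodeEntries []      = 0
encodeEntries (i ∷ p) = pair i (encodeEntries p)

decodeEntries : ℕ → ℕ → List ℕ
decodeEntries zero    m = []
decodeEntries (suc l) m = proj₁ (unpair m) ∷ decodeEntries l (proj₂ (unpair m))

decodeEntries-encode : ∀ p → decodeEntries (length p) (encodeEntries p) ≡ p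
decodeEntries-encode []      = refl
decodeEntries-encode (i ∷ p) rewrite unpair-pair i (encodeEntries p) =
  cong (i ∷_) (decodeEntries-encode p)

encodePath : List ℕ → ℕ
encodePath p = pair (length p) (encodeEntries p)

decodePath : ℕ → List ℕ
decodePath n = decodeEntries (proj₁ (unpair n)) (proj₂ (unpair n))

decodePath-encode : ∀ p → decodePath (encodePath p) ≡ p
decodePath-encode p rewrite unpair-pair (length p) (encodeEntries p) =
  decodeEntries-encode p

module _ {S : Signature} where

  bind-map : ∀ {a b c} {X : Set a} {Y : Set b} {Z : Set c}
    (h : Y → T S Z) (g : X → Y) (t : T S X) →
    μ (mapT h (mapT g t)) ≗ μ (mapT (h ∘ g) t)
  bind-map h g t p with t []
  bind-map h g t p       | leaf x = refl
  bind-map h g t []      | bot    = refl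
  bind-map h g t []      | top    = refl
  bind-map h g t []      | op σ   = refl
  bind-map h g t (i ∷ q) | bot    = bind-map h g (child t i) q
  bind-map h g t (i ∷ q) | top    = bind-map h g (child t i) q
  bind-map h g t (i ∷ q) | op σ   = bind-map h g (child t i) q

  map-bind : ∀ {a b c} {X : Set a} {Y : Set b} {Z : Set c}
    (k : Y → Z) (h : X → T S Y) (t : T S X) →
    mapT k (μ (mapT h t)) ≗ μ (mapT (mapT k ∘ h) t)
  map-bind k h t p with t []
  map-bind k h t p       | leaf x = refl
  map-bind k h t []      | bot    = refl
  map-bind k h t []      | top    = refl
  map-bind k h t []      | op σ   = refl
  map-bind k h t (i ∷ q) | bot    = map-bind k h (child t i) q
  map-bind k h t (i ∷ q) | top    = map-bind k h (child t i) q
  map-bind k h t (i ∷ q) | op σ   = map-bind k h (child t i) q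

  bind-μ : ∀ {a b} {X : Set a} {Y : Set b}
    (h : X → T S Y) (t : T S (T S X)) →
    μ (mapT h (μ t)) ≗ μ (mapT (μ ∘ mapT h) t)
  bind-μ h t p with t []
  bind-μ h t p       | leaf s = refl
  bind-μ h t []      | bot    = refl
  bind-μ h t []      | top    = refl
  bind-μ h t []      | op σ   = refl
  bind-μ h t (i ∷ q) | bot    = bind-μ h (child t i) q
  bind-μ h t (i ∷ q) | top    = bind-μ h (child t i) q
  bind-μ h t (i ∷ q) | op σ   = bind-μ h (child t i) q

  relabelLeaves : ∀ {a} {Y : Set a} → T S Y → (List ℕ → ℕ) → Tℕ {S}
  relabelLeaves t κ p = mapLab (λ _ → κ p) (t p)

  bind-relabelLeaves : ∀ {a} {Y : Set a} (t : T S Y) (κ : List ℕ → ℕ)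
    (f : ℕ → Tℕ {S}) (φ : Y → Tℕ {S}) →
    (∀ p y → t p ≡ leaf y → f (κ p) ≡ φ y) →
    μ (mapT f (relabelLeaves t κ)) ≗ μ (mapT φ t)
  bind-relabelLeaves t κ f φ agree p with t [] in root
  bind-relabelLeaves t κ f φ agree p       | leaf y = cong (λ s → s p) (agree [] y root)
  bind-relabelLeaves t κ f φ agree []      | bot    = refl
  bind-relabelLeaves t κ f φ agree []      | top    = refl
  bind-relabelLeaves t κ f φ agree []      | op σ   = refl
  bind-relabelLeaves t κ f φ agree (i ∷ q) | bot    =
    bind-relabelLeaves (child t i) (κ ∘ (i ∷_)) f φ (agree ∘ (i ∷_)) q
  bind-relabelLeaves t κ f φ agree (i ∷ q) | top    =
    bind-relabelLeaves (child t i) (κ ∘ (i ∷_)) f φ (agree ∘ (i ∷_)) q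
  bind-relabelLeaves t κ f φ agree (i ∷ q) | op σ   =
    bind-relabelLeaves (child t i) (κ ∘ (i ∷_)) f φ (agree ∘ (i ∷_)) q

  atLeaf : ∀ {a} {Y : Set a} → (Y → Tℕ {S}) → Lab S Y → Tℕ {S}
  atLeaf φ (leaf y) = φ y
  atLeaf φ _        = λ _ → bot

  module _ (E : AlgRel {S}) (refl-E : IsReflexive E)
           (comp-E : IsCompositional E) (resp-E : RespectsEq E) where

    -- Compositionality for leaves in an arbitrary set Y: substitute
    -- along the relabelled tree, reading each leaf's path back from its code.
    bind-monotone : ∀ {a} {Y : Set a} (t : T S Y) (φ ψ : Y → Tℕ {S}) →
      (∀ y → E (φ y) (ψ y)) → E (μ (mapT φ t)) (μ (mapT ψ t))
    bind-monotone {Y = Y} t φ ψ φEψ =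
      resp-E (λ p _ → bind-relabelLeaves t encodePath f φ (readsBack φ) p)
             (λ p _ → bind-relabelLeaves t encodePath g ψ (readsBack ψ) p)
             (comp-E f g (refl-E (relabelLeaves t encodePath)) fEg)
      where
      f g : ℕ → Tℕ {S}
      f n = atLeaf φ (t (decodePath n))
      g n = atLeaf ψ (t (decodePath n))

      readsBack : (χ : Y → Tℕ {S}) → ∀ p y → t p ≡ leaf y →
        atLeaf χ (t (decodePath (encodePath p))) ≡ χ y
      readsBack χ p y tp rewrite decodePath-encode p | tp = refl

      atLeaf-E : ∀ l → E (atLeaf φ l) (atLeaf ψ l)
      atLeaf-E (leaf y) = φEψ y
      atLeaf-E bot      = refl-E _
      atLeaf-E top      = refl-E _
      atLeaf-E (op σ)   = refl-E _

      fEg : ∀ n → E (f n) (g n)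
      fEg n = atLeaf-E (t (decodePath n))

  module _ (E : AlgRel {S}) (trans-E : IsTransitive E) where

    member-class : (C : Class E) (b : T𝟎) → _∈C_ E b C → _≐_ E ([_] E b) C
    member-class (P , a , isClass) b b∈C x = mk⇔ toP fromP
      where
      a~b : ⟦ E ⟧ a b
      a~b = Equivalence.to (isClass b) b∈C

      toP : ⟦ E ⟧ b x → P x
      toP (bx , xb) =
        Equivalence.from (isClass x) (trans-E (proj₁ a~b) bx , trans-E xb (proj₂ a~b))

      fromP : P x → ⟦ E ⟧ b x
      fromP Px with Equivalence.to (isClass x) Px
      ... | ax , xa = trans-E (proj₂ a~b) ax , trans-E xa (proj₁ a~b)

  module _ (E : AlgRel {S}) (refl-E : IsReflexive E) (comp-E : IsCompositional E)
           (resp-E : RespectsEq E) (ch : ChoiceFunction E) where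

    -- The two trees substituted into t in the multiplication law, included
    -- into Tℕ: c [c* s] (the chosen member of α s) and c* s itself.
    chosenOfClass repOfTree : T S (Class E) → Tℕ {S}
    chosenOfClass s = incl (c ch (α E ch s))
    repOfTree     s = μ (mapT (incl ∘ c ch) s)

    incl-rep : ∀ s → incl (μ (mapT (c ch) s)) ≗ repOfTree s
    incl-rep = map-bind ⊥-elim (c ch)

    -- c [x] ∈ [x] for x = c* s: the two substituted trees are 𝓔-equivalent.
    chosen-E-rep : ∀ s → E (chosenOfClass s) (repOfTree s)
    chosen-E-rep s = resp-E (λ _ _ → refl) (λ p _ → incl-rep s p)
                            (proj₂ (c∈ ch (α E ch s)))

    rep-E-chosen : ∀ s → E (repOfTree s) (chosenOfClass s)
    rep-E-chosen s = resp-E (λ p _ → incl-rep s p) (λ _ _ → refl)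
                            (proj₁ (c∈ ch (α E ch s)))

    incl-rep-Tα : (t : T S (T S (Class E))) →
      incl (μ (mapT (c ch) (mapT (α E ch) t))) ≗ μ (mapT chosenOfClass t)
    incl-rep-Tα t p = trans (incl-rep (mapT (α E ch) t) p)
                            (bind-map (incl ∘ c ch) (α E ch) t p)

    incl-rep-μ : (t : T S (T S (Class E))) →
      incl (μ (mapT (c ch) (μ t))) ≗ μ (mapT repOfTree t)
    incl-rep-μ t p = trans (incl-rep (μ t) p) (bind-μ (incl ∘ c ch) t p)

    rep-μ-equiv-rep-Tα : (t : T S (T S (Class E))) →
      ⟦ E ⟧ (μ (mapT (c ch) (μ t))) (μ (mapT (c ch) (mapT (α E ch) t)))
    rep-μ-equiv-rep-Tα t =
      resp-E (λ p _ → sym (incl-rep-μ t p)) (λ p _ → sym (incl-rep-Tα t p))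
             (bind-monotone E refl-E comp-E resp-E t repOfTree chosenOfClass rep-E-chosen) ,
      resp-E (λ p _ → sym (incl-rep-Tα t p)) (λ p _ → sym (incl-rep-μ t p))
             (bind-monotone E refl-E comp-E resp-E t chosenOfClass repOfTree chosen-E-rep)

mainTheorem6 : (S : Signature) (E : AlgRel {S}) →
    IsReflexive E → IsTransitive E → IsCompositional E → RespectsEq E →
    (ch : ChoiceFunction E) →
    ((C : Class E) → _≐_ E (α E ch (η C)) C)
    × ((t : T S (T S (Class E))) → _≐_ E (α E ch (mapT (α E ch) t)) (α E ch (μ t)))
mainTheorem6 S E refl-E trans-E comp-E resp-E ch = unit-law , multiplication-law
  where
  -- α (η C) = [c C], and c C ∈ C.
  unit-law : (C : Class E) → _≐_ E (α E ch (η C)) C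
  unit-law C = member-class E trans-E C (c ch C) (c∈ ch C)

  -- The representative of α (T α t) lies in the class α (μ t).
  multiplication-law : (t : T S (T S (Class E))) →
    _≐_ E (α E ch (mapT (α E ch) t)) (α E ch (μ t))
  multiplication-law t =
    member-class E trans-E (α E ch (μ t)) (μ (mapT (c ch) (mapT (α E ch) t)))
                 (rep-μ-equiv-rep-Tα E refl-E comp-E resp-E ch t)
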